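{- Define sets $X_n$ of words as follows: $X_1=\{1\}$, $X_2=\{11,12\}$, $X_3$ is the set of words obtained from some $f'\in X_2$ by appending $2$ or $3$ at its end, and for $n\ge4$, $X_n$ is the set of words obtained either from some $f'\in X_{n-1}$ by appending $n-1$ or $n$ at its end, or from some $f'\in X_{n-3}$ by appending the word $(n-3)(n-3)(n-2)$ at its end. Then for every $n\ge1$ and every $f\in X_n$, $f\in F_n^{\nearrow}$ and $\phi(f)\in\mathfrak{S}_n^{\nearrow}(231)$.
   Context: $[n]=\{1,\dots,n\}$, $\mathfrak{S}_n$ the symmetric group on $[n]$; products of permutations are composed with the leftmost factor acting first: $(\alpha\beta)(x)=\beta(\alpha(x))$. A function $f:[n]\to[n]$ is subexceedant if $1\le f(i)\le i$ for all $i$, written $f_1\cdots f_n$; $F_n$ is the set of such functions. $\phi:F_n\to\mathfrak{S}_n$, $\phi(f)=(1,f_1)(2,f_2)\cdots(n,f_n)$ (with $(i,i)$ the identity). $F_n^{\nearrow}$ is the set of non-decreasing subexceedant functions on $[n]$ and $\mathfrak{S}_n^{\nearrow}=\phi(F_n^{\nearrow})$. $\mathfrak{S}_n^{\nearrow}(231)$ is the set of $\sigma\in\mathfrak{S}_n^{\nearrow}$ for which there are no $a<b<c$ with $\sigma(c)<\sigma(a)<\sigma(b)$. -}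

module Defs where

open import Data.Nat using (ℕ; zero; suc; _+_; _∸_; _≤_; _<_)
open import Data.Nat.Properties using (_≟_)
open import Data.List using (List; []; _∷_; _++_; [_]; length)
open import Data.Product using (Σ; _×_; _,_)
open import Data.Sum using (_⊎_)
open import Relation.Nullary using (¬_; yes; no)
open import Relation.Binary.PropositionalEquality using (_≡_)

-- Words are lists of naturals; the i-th letter (1-indexed) of a word.
-- Out-of-range positions give 0 (never used within [n] once length f ≡ n).
at : List ℕ → ℕ → ℕ
at []       _             = 0
at (x ∷ xs) zero          = 0
at (x ∷ xs) (suc zero)    = x
at (x ∷ xs) (suc (suc i)) = at xs (suc i)

Subexceedant : ℕ → List ℕ → Set
Subexceedant n f =
  length f ≡ n × (∀ i → 1 ≤ i → i ≤ n → 1 ≤ at f i × at f i ≤ i)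

NondecSubexceedant : ℕ → List ℕ → Set
NondecSubexceedant n f =
  Subexceedant n f × (∀ i j → 1 ≤ i → i ≤ j → j ≤ n → at f i ≤ at f j)

swap : ℕ → ℕ → ℕ → ℕ
swap i j x with x ≟ i
... | yes _ = j
... | no _ with x ≟ j
...   | yes _ = i
...   | no _  = x

-- φ(f) = (1,f_1)(2,f_2)⋯(n,f_n), leftmost factor acting first:
-- φ(f)(x) = τ_n(⋯ τ_2(τ_1(x))), where τ_i = (i, f_i).
phiFrom : ℕ → List ℕ → ℕ → ℕ
phiFrom i []       x = x
phiFrom i (a ∷ as) x = phiFrom (suc i) as (swap i a x)

phi : List ℕ → ℕ → ℕ
phi f = phiFrom 1 f

-- σ ∈ 𝔖_n^↗ = φ(F_n^↗) (permutations compared as functions on [n])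
InSnNondec : ℕ → (ℕ → ℕ) → Set
InSnNondec n σ =
  Σ (List ℕ) λ g → NondecSubexceedant n g × (∀ x → 1 ≤ x → x ≤ n → phi g x ≡ σ x)

Avoids231 : ℕ → (ℕ → ℕ) → Set
Avoids231 n σ =
  ∀ a b c → 1 ≤ a → a < b → b < c → c ≤ n → ¬ (σ c < σ a × σ a < σ b)

InSnNondec231 : ℕ → (ℕ → ℕ) → Set
InSnNondec231 n σ = InSnNondec n σ × Avoids231 n σ

-- The "append n-1 or n" rule for X_{n} (n ≥ 3) is written with n = suc m, m ≥ 2
-- (m = 2 gives the X_3 rule, m ≥ 3 the first rule for n ≥ 4).
-- The jump rule for n ≥ 4 is written with n = m + 3, m ≥ 1.
data X : ℕ → List ℕ → Set where
  X1     : X 1 (1 ∷ [])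
  X2a    : X 2 (1 ∷ 1 ∷ [])
  X2b    : X 2 (1 ∷ 2 ∷ [])
  stepA  : ∀ {m f} → 2 ≤ m → X m f → X (suc m) (f ++ [ m ])
  stepB  : ∀ {m f} → 2 ≤ m → X m f → X (suc m) (f ++ [ suc m ])
  jump   : ∀ {m f} → 1 ≤ m → X m f → X (m + 3) (f ++ (m ∷ m ∷ suc m ∷ []))

-- Induction along the rules defining X_n, with invariant: f ∈ F_n^↗ and φ(f) avoids 231.
-- φ(f ++ w) is φ(f) followed by the transpositions of w, and φ(f) stabilises [n] when f is
-- subexceedant of length n, so each rule acts on values: appending n+1 adds the fixed point
-- n+1 on top; appending n relabels the value n as n+1 and puts n at the new position;
-- appending n n (n+1) relabels the value n as n+3 and puts n+2, n, n+1 at the new positions.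
-- In the last two cases a 231 occurrence a < b < c with c new has φ(a) > φ(c) ≥ n, so φ(a)
-- is the relabelled top value and no φ(b) exceeds it; the new positions alone carry no 231.
module Submission where

open import Defs
open import Data.Nat using (ℕ; zero; suc; _+_; _≤_; _<_; z≤n; s≤s; z<s)
open import Data.Nat.Properties
open import Data.List using (List; []; _∷_; _++_; [_]; length)
open import Data.List.Properties using (length-++; ++-assoc)
open import Data.List.Relation.Unary.All using (All; []; _∷_)
open import Data.Product using (_×_; _,_; proj₁)
open import Data.Sum using (_⊎_; inj₁; inj₂)
open import Relation.Nullary using (¬_; yes; no; contradiction)
open import Relation.Binary.PropositionalEquality hiding ([_])

swap-≡ˡ : ∀ i j → swap i j i ≡ j
swap-≡ˡ i j with i ≟ i
... | yes _  = refl
... | no i≢i = contradiction refl i≢i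

swap-≡ʳ : ∀ i j → swap i j j ≡ i
swap-≡ʳ i j with j ≟ i
... | yes j≡i = j≡i
... | no _ with j ≟ j
...   | yes _  = refl
...   | no j≢j = contradiction refl j≢j

swap-≢ : ∀ i j x → x ≢ i → x ≢ j → swap i j x ≡ x
swap-≢ i j x x≢i x≢j with x ≟ i
... | yes x≡i = contradiction x≡i x≢i
... | no _ with x ≟ j
...   | yes x≡j = contradiction x≡j x≢j
...   | no _    = refl

swap-self : ∀ i x → swap i i x ≡ x
swap-self i x with x ≟ i
... | yes x≡i = sym x≡i
... | no _ with x ≟ i
...   | yes x≡i = sym x≡i
...   | no _    = refl

swap-≤ : ∀ {i j x k} → i ≤ k → j ≤ k → x ≤ k → swap i j x ≤ k
swap-≤ {i} {j} {x} i≤k j≤k x≤k with x ≟ i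
... | yes _ = j≤k
... | no _ with x ≟ j
...   | yes _ = i≤k
...   | no _  = x≤k

at-∷ʳ-init : ∀ f a i → i ≤ length f → at (f ++ [ a ]) i ≡ at f i
at-∷ʳ-init []      a zero          _         = refl
at-∷ʳ-init (x ∷ f) a zero          _         = refl
at-∷ʳ-init (x ∷ f) a (suc zero)    _         = refl
at-∷ʳ-init (x ∷ f) a (suc (suc i)) (s≤s i≤) = at-∷ʳ-init f a (suc i) i≤

at-∷ʳ-last : ∀ {n} f a → length f ≡ n → at (f ++ [ a ]) (suc n) ≡ a
at-∷ʳ-last []      a refl = refl
at-∷ʳ-last (x ∷ f) a refl = at-∷ʳ-last f a refl

All-from-at : ∀ {P : ℕ → Set} f → (∀ i → 1 ≤ i → i ≤ length f → P (at f i)) → All P f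
All-from-at []      _ = []
All-from-at (x ∷ f) h =
  h 1 ≤-refl (s≤s z≤n) ∷
  All-from-at f λ { (suc i) _ i≤ → h (suc (suc i)) (s≤s z≤n) (s≤s i≤) }

Subexceedant⇒All≤ : ∀ {n f} → Subexceedant n f → All (_≤ n) f
Subexceedant⇒All≤ {f = f} (refl , bounds) =
  All-from-at f λ i 1≤i i≤n → let (_ , fᵢ≤i) = bounds i 1≤i i≤n in ≤-trans fᵢ≤i i≤n

NondecSubexceedant-∷ʳ : ∀ {n} f a → NondecSubexceedant n f →
  at f n ≤ a → 1 ≤ a → a ≤ suc n →
  NondecSubexceedant (suc n) (f ++ [ a ])
NondecSubexceedant-∷ʳ {n} f a ((refl , bounds) , nondec) fₙ≤a 1≤a a≤1+n =
  (trans (length-++ f) (+-comm n 1) , bounds′) , nondec′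
  where
  f′ = f ++ [ a ]
  init : ∀ {i} → i ≤ n → at f′ i ≡ at f i
  init = at-∷ʳ-init f a _
  split : ∀ {i} → i ≤ suc n → i ≤ n ⊎ i ≡ suc n
  split i≤1+n with m≤n⇒m<n∨m≡n i≤1+n
  ... | inj₁ i<1+n = inj₁ (≤-pred i<1+n)
  ... | inj₂ i≡1+n = inj₂ i≡1+n
  bounds′ : ∀ i → 1 ≤ i → i ≤ suc n → 1 ≤ at f′ i × at f′ i ≤ i
  bounds′ i 1≤i i≤1+n with split i≤1+n
  ... | inj₁ i≤n  rewrite init i≤n = bounds i 1≤i i≤n
  ... | inj₂ refl rewrite at-∷ʳ-last f a refl = 1≤a , a≤1+n
  nondec′ : ∀ i j → 1 ≤ i → i ≤ j → j ≤ suc n → at f′ i ≤ at f′ j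
  nondec′ i j 1≤i i≤j j≤1+n with split j≤1+n
  ... | inj₁ j≤n rewrite init (≤-trans i≤j j≤n) | init j≤n = nondec i j 1≤i i≤j j≤n
  ... | inj₂ refl with split i≤j
  ...   | inj₁ i≤n rewrite init i≤n | at-∷ʳ-last f a refl =
    ≤-trans (nondec i n 1≤i i≤n ≤-refl) fₙ≤a
  ...   | inj₂ refl = ≤-refl

phiFrom-++ : ∀ i f g x → phiFrom i (f ++ g) x ≡ phiFrom (length f + i) g (phiFrom i f x)
phiFrom-++ i []      g x = refl
phiFrom-++ i (a ∷ f) g x rewrite phiFrom-++ (suc i) f g (swap i a x) | +-suc (length f) i = refl

phi-++ : ∀ {n} f g x → length f ≡ n → phi (f ++ g) x ≡ phiFrom (suc n) g (phi f x)
phi-++ f g x refl rewrite phiFrom-++ 1 f g x | +-comm (length f) 1 = refl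

phiFrom-fixes : ∀ {k} i f x → All (_≤ k) f → i + length f ≤ suc k → k < x →
  phiFrom i f x ≡ x
phiFrom-fixes         i []      x _            _     _   = refl
phiFrom-fixes {k} i (a ∷ f) x (a≤k ∷ f≤k) bound k<x =
  trans (cong (phiFrom (suc i) f)
               (swap-≢ i a x (>⇒≢ (≤-<-trans i≤k k<x)) (>⇒≢ (≤-<-trans a≤k k<x))))
        (phiFrom-fixes (suc i) f x f≤k bound′ k<x)
  where
  bound′ : suc i + length f ≤ suc k
  bound′ = subst (_≤ suc k) (+-suc i (length f)) bound
  i≤k : i ≤ k
  i≤k = ≤-pred (m+n≤o⇒m≤o (suc i) bound′)

phiFrom-≤ : ∀ {k} i f x → All (_≤ k) f → i + length f ≤ suc k → x ≤ k →
  phiFrom i f x ≤ k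
phiFrom-≤     i []      x _            _     x≤k = x≤k
phiFrom-≤ {k} i (a ∷ f) x (a≤k ∷ f≤k) bound x≤k =
  phiFrom-≤ (suc i) f _ f≤k bound′ (swap-≤ i≤k a≤k x≤k)
  where
  bound′ : suc i + length f ≤ suc k
  bound′ = subst (_≤ suc k) (+-suc i (length f)) bound
  i≤k : i ≤ k
  i≤k = ≤-pred (m+n≤o⇒m≤o (suc i) bound′)

phi-fixes : ∀ {n x} f → Subexceedant n f → n < x → phi f x ≡ x
phi-fixes {x = x} f sub@(refl , _) = phiFrom-fixes 1 f x (Subexceedant⇒All≤ sub) ≤-refl

phi-≤ : ∀ {n x} f → Subexceedant n f → x ≤ n → phi f x ≤ n
phi-≤ {x = x} f sub@(refl , _) = phiFrom-≤ 1 f x (Subexceedant⇒All≤ sub) ≤-refl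

Subexceedant-last : ∀ {n} f → Subexceedant n f → at f n ≤ n
Subexceedant-last {zero}  []      _            = z≤n
Subexceedant-last {zero}  (_ ∷ _) _            = z≤n
Subexceedant-last {suc n} _       (_ , bounds) with bounds (suc n) (s≤s z≤n) ≤-refl
... | _ , fₙ≤n = fₙ≤n

data Raise (m T : ℕ) : ℕ → ℕ → Set where
  below : ∀ {v} → v < m → Raise m T v v
  top   : Raise m T m T

Raise-cases : ∀ {m T v w} → Raise m T v w → w < m ⊎ w ≡ T
Raise-cases (below v<m) = inj₁ v<m
Raise-cases top         = inj₂ refl

Raise-reflects-< : ∀ {m T v v′ w w′} → m ≤ T →
  Raise m T v v′ → Raise m T w w′ → v′ < w′ → v < w
Raise-reflects-< _   (below _)   (below _)   v<w = v<w
Raise-reflects-< _   (below v<m) top         _   = v<m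
Raise-reflects-< m≤T top         (below w<m) T<w = contradiction (<-≤-trans w<m m≤T) (<⇒≯ T<w)
Raise-reflects-< _   top         top         T<T = contradiction T<T (n≮n _)

Avoids231-cong : ∀ {n} {σ τ : ℕ → ℕ} → (∀ x → σ x ≡ τ x) → Avoids231 n σ → Avoids231 n τ
Avoids231-cong σ≗τ avoids a b c 1≤a a<b b<c c≤n
  rewrite sym (σ≗τ a) | sym (σ≗τ b) | sym (σ≗τ c) = avoids a b c 1≤a a<b b<c c≤n

Avoids231-fixedTop : ∀ {m} {σ : ℕ → ℕ} → Avoids231 m σ → (∀ x → x ≤ m → σ x ≤ m) →
  σ (suc m) ≡ suc m → Avoids231 (suc m) σ
Avoids231-fixedTop {m} {σ} avoids bounded σ[1+m] a b c 1≤a a<b b<c c≤1+m (c<a , a<b′)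
  with m≤n⇒m<n∨m≡n c≤1+m
... | inj₁ c<1+m = avoids a b c 1≤a a<b b<c (≤-pred c<1+m) (c<a , a<b′)
... | inj₂ refl  =
  ≤⇒≯ (bounded a (≤-pred (<-trans a<b b<c))) (<-trans (n<1+n m) (subst (_< σ a) σ[1+m] c<a))

Avoids231-raise : ∀ {m N} {σ σ′ : ℕ → ℕ} → m ≤ N → Avoids231 m σ →
  (∀ x → x ≤ m → Raise m N (σ x) (σ′ x)) →
  (∀ x → m < x → x ≤ N → m ≤ σ′ x) →
  (∀ x → x ≤ N → σ′ x ≤ N) →
  (∀ a b c → m < a → a < b → b < c → c ≤ N → ¬ (σ′ c < σ′ a × σ′ a < σ′ b)) →
  Avoids231 N σ′
Avoids231-raise {m} {σ′ = σ′} m≤N avoids raise new≥m bounded newAvoids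
                a b c 1≤a a<b b<c c≤N (c<a , a<b′)
  with ≤-<-connex c m | ≤-<-connex a m
... | inj₁ c≤m | _ =
  avoids a b c 1≤a a<b b<c c≤m
    ( Raise-reflects-< m≤N (raise c c≤m) (raise a a≤m) c<a
    , Raise-reflects-< m≤N (raise a a≤m) (raise b b≤m) a<b′)
  where
  b≤m = ≤-trans (<⇒≤ b<c) c≤m
  a≤m = ≤-trans (<⇒≤ a<b) b≤m
... | inj₂ _   | inj₂ m<a = newAvoids a b c m<a a<b b<c c≤N (c<a , a<b′)
... | inj₂ m<c | inj₁ a≤m with Raise-cases (raise a a≤m)
...   | inj₁ σ′a<m = <⇒≱ (<-trans c<a σ′a<m) (new≥m c m<c c≤N)
...   | inj₂ σ′a≡N =
  <⇒≱ (subst (_< σ′ b) σ′a≡N a<b′) (bounded b (≤-trans (<⇒≤ b<c) c≤N))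

m<1+k+m : ∀ k m → m < suc k + m
m<1+k+m k m = m<n+m m {suc k} z<s

swap-raise : ∀ {m v} → v ≤ m → Raise m (suc m) v (swap (suc m) m v)
swap-raise {m} {v} v≤m with m≤n⇒m<n∨m≡n v≤m
... | inj₁ v<m rewrite swap-≢ (suc m) m v (<⇒≢ (<-trans v<m (m<1+k+m 0 m))) (<⇒≢ v<m) =
  below v<m
... | inj₂ refl rewrite swap-≡ʳ (suc m) m = top

-- The transpositions (m+1, m)(m+2, m)(m+3, m+1) contributed by the letters m m (m+1).
jumpSwaps : ℕ → ℕ → ℕ
jumpSwaps m v = swap (3 + m) (1 + m) (swap (2 + m) m (swap (1 + m) m v))

jumpSwaps-raise : ∀ {m v} → v ≤ m → Raise m (3 + m) v (jumpSwaps m v)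
jumpSwaps-raise {m} {v} v≤m with m≤n⇒m<n∨m≡n v≤m
... | inj₁ v<m
  rewrite swap-≢ (1 + m) m v (<⇒≢ (<-trans v<m (m<1+k+m 0 m))) (<⇒≢ v<m)
        | swap-≢ (2 + m) m v (<⇒≢ (<-trans v<m (m<1+k+m 1 m))) (<⇒≢ v<m)
        | swap-≢ (3 + m) (1 + m) v (<⇒≢ (<-trans v<m (m<1+k+m 2 m)))
                                   (<⇒≢ (<-trans v<m (m<1+k+m 0 m)))
  = below v<m
... | inj₂ refl
  rewrite swap-≡ʳ (1 + m) m
        | swap-≢ (2 + m) m (1 + m) (<⇒≢ (m<1+k+m 0 (1 + m))) (>⇒≢ (m<1+k+m 0 m))
        | swap-≡ʳ (3 + m) (1 + m)
  = top

jumpSwaps-1+m : ∀ m → jumpSwaps m (1 + m) ≡ 2 + m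
jumpSwaps-1+m m rewrite swap-≡ˡ (1 + m) m | swap-≡ʳ (2 + m) m =
  swap-≢ (3 + m) (1 + m) (2 + m) (<⇒≢ (m<1+k+m 0 (2 + m))) (>⇒≢ (m<1+k+m 0 (1 + m)))

jumpSwaps-2+m : ∀ m → jumpSwaps m (2 + m) ≡ m
jumpSwaps-2+m m
  rewrite swap-≢ (1 + m) m (2 + m) (>⇒≢ (m<1+k+m 0 (1 + m))) (>⇒≢ (m<1+k+m 1 m))
        | swap-≡ˡ (2 + m) m
  = swap-≢ (3 + m) (1 + m) m (<⇒≢ (m<1+k+m 2 m)) (<⇒≢ (m<1+k+m 0 m))

jumpSwaps-3+m : ∀ m → jumpSwaps m (3 + m) ≡ 1 + m
jumpSwaps-3+m m
  rewrite swap-≢ (1 + m) m (3 + m) (>⇒≢ (m<1+k+m 1 (1 + m))) (>⇒≢ (m<1+k+m 2 m))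
        | swap-≢ (2 + m) m (3 + m) (>⇒≢ (m<1+k+m 0 (2 + m))) (>⇒≢ (m<1+k+m 2 m))
  = swap-≡ˡ (3 + m) (1 + m)

between-three : ∀ {m x} → m < x → x ≤ 3 + m → x ≡ 1 + m ⊎ x ≡ 2 + m ⊎ x ≡ 3 + m
between-three {zero}  {1}                       _         _ = inj₁ refl
between-three {zero}  {2}                       _         _ = inj₂ (inj₁ refl)
between-three {zero}  {3}                       _         _ = inj₂ (inj₂ refl)
between-three {zero}  {suc (suc (suc (suc _)))} _         (s≤s (s≤s (s≤s ())))
between-three {suc m} {suc x}                   (s≤s m<x) (s≤s x≤3+m)
  with between-three m<x x≤3+m
... | inj₁ x≡1+m        = inj₁ (cong suc x≡1+m)
... | inj₂ (inj₁ x≡2+m) = inj₂ (inj₁ (cong suc x≡2+m))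
... | inj₂ (inj₂ x≡3+m) = inj₂ (inj₂ (cong suc x≡3+m))

Nondec231 : ℕ → List ℕ → Set
Nondec231 n f = NondecSubexceedant n f × Avoids231 n (phi f)

Nondec231-[] : Nondec231 0 []
Nondec231-[] = ((refl , λ i 1≤i i≤0 → contradiction i≤0 (<⇒≱ 1≤i))
               , λ i j 1≤i i≤j j≤0 → contradiction j≤0 (<⇒≱ (≤-trans 1≤i i≤j)))
             , λ a b c 1≤a a<b b<c c≤0 →
                 contradiction c≤0 (<⇒≱ (≤-trans 1≤a (<⇒≤ (<-trans a<b b<c))))

Nondec231-∷ʳ-suc-length : ∀ {m} f → Nondec231 m f → Nondec231 (suc m) (f ++ [ suc m ])
Nondec231-∷ʳ-suc-length {m} f (nondec@(sub@(length≡m , _) , _) , avoids) =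
  NondecSubexceedant-∷ʳ f (suc m) nondec (m≤n⇒m≤1+n (Subexceedant-last f sub)) z<s ≤-refl ,
  Avoids231-cong phi-unchanged
    (Avoids231-fixedTop avoids (λ _ → phi-≤ f sub) (phi-fixes f sub ≤-refl))
  where
  phi-unchanged : ∀ x → phi f x ≡ phi (f ++ [ suc m ]) x
  phi-unchanged x = sym (trans (phi-++ f [ suc m ] x length≡m) (swap-self (suc m) (phi f x)))

Nondec231-∷ʳ-length : ∀ {m} f → 1 ≤ m → Nondec231 m f → Nondec231 (suc m) (f ++ [ m ])
Nondec231-∷ʳ-length {m} f 1≤m (nondec@(sub@(length≡m , _) , _) , avoids) =
  nondec′ ,
  Avoids231-raise (n≤1+n m) avoids raise new≥m (λ _ → phi-≤ f′ (proj₁ nondec′)) noNewTriple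
  where
  f′ = f ++ [ m ]
  nondec′ : NondecSubexceedant (suc m) f′
  nondec′ = NondecSubexceedant-∷ʳ f m nondec (Subexceedant-last f sub) 1≤m (n≤1+n m)
  σ′≡ : ∀ x → phi f′ x ≡ swap (suc m) m (phi f x)
  σ′≡ x = phi-++ f [ m ] x length≡m
  raise : ∀ x → x ≤ m → Raise m (suc m) (phi f x) (phi f′ x)
  raise x x≤m = subst (Raise m (suc m) (phi f x)) (sym (σ′≡ x)) (swap-raise (phi-≤ f sub x≤m))
  σ′[1+m] : phi f′ (suc m) ≡ m
  σ′[1+m] = begin
    phi f′ (suc m)                 ≡⟨ σ′≡ (suc m) ⟩
    swap (suc m) m (phi f (suc m)) ≡⟨ cong (swap (suc m) m) (phi-fixes f sub (n<1+n m)) ⟩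
    swap (suc m) m (suc m)         ≡⟨ swap-≡ˡ (suc m) m ⟩
    m                              ∎
    where open ≡-Reasoning
  new≥m : ∀ x → m < x → x ≤ suc m → m ≤ phi f′ x
  new≥m x m<x x≤1+m rewrite ≤-antisym x≤1+m m<x = ≤-reflexive (sym σ′[1+m])
  noNewTriple : ∀ a b c → m < a → a < b → b < c → c ≤ suc m →
    ¬ (phi f′ c < phi f′ a × phi f′ a < phi f′ b)
  noNewTriple a b c m<a a<b b<c c≤1+m _ = <⇒≱ (<-trans (≤-trans (s≤s m<a) a<b) b<c) c≤1+m

Nondec231-++-jump : ∀ {m} f → 1 ≤ m → Nondec231 m f →
  Nondec231 (3 + m) (f ++ m ∷ m ∷ suc m ∷ [])
Nondec231-++-jump {m} f 1≤m (nondec@(sub@(length≡m , _) , _) , avoids) =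
  nondec′ ,
  Avoids231-raise (m≤n+m m 3) avoids raise new≥m (λ _ → phi-≤ f′ (proj₁ nondec′)) noNewTriple
  where
  f′ = f ++ m ∷ m ∷ suc m ∷ []
  nondec₁ : NondecSubexceedant (1 + m) (f ++ [ m ])
  nondec₁ = NondecSubexceedant-∷ʳ f m nondec (Subexceedant-last f sub) 1≤m (m≤n+m m 1)
  nondec₂ : NondecSubexceedant (2 + m) ((f ++ [ m ]) ++ [ m ])
  nondec₂ = NondecSubexceedant-∷ʳ (f ++ [ m ]) m nondec₁
    (≤-reflexive (at-∷ʳ-last f m length≡m)) 1≤m (m≤n+m m 2)
  nondec₃ : NondecSubexceedant (3 + m) (((f ++ [ m ]) ++ [ m ]) ++ [ suc m ])
  nondec₃ = NondecSubexceedant-∷ʳ ((f ++ [ m ]) ++ [ m ]) (suc m) nondec₂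
    (m≤n⇒m≤1+n (≤-reflexive (at-∷ʳ-last (f ++ [ m ]) m (proj₁ (proj₁ nondec₁))))) z<s
    (m≤n+m (suc m) 2)
  nondec′ : NondecSubexceedant (3 + m) f′
  nondec′ = subst (NondecSubexceedant (3 + m))
    (trans (++-assoc (f ++ [ m ]) [ m ] [ suc m ]) (++-assoc f [ m ] (m ∷ suc m ∷ []))) nondec₃
  σ′≡ : ∀ x → phi f′ x ≡ jumpSwaps m (phi f x)
  σ′≡ x = phi-++ f (m ∷ m ∷ suc m ∷ []) x length≡m
  σ′-new : ∀ x → m < x → phi f′ x ≡ jumpSwaps m x
  σ′-new x m<x = trans (σ′≡ x) (cong (jumpSwaps m) (phi-fixes f sub m<x))
  raise : ∀ x → x ≤ m → Raise m (3 + m) (phi f x) (phi f′ x)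
  raise x x≤m =
    subst (Raise m (3 + m) (phi f x)) (sym (σ′≡ x)) (jumpSwaps-raise (phi-≤ f sub x≤m))
  σ′[1+m] : phi f′ (1 + m) ≡ 2 + m
  σ′[1+m] = trans (σ′-new (1 + m) (m<1+k+m 0 m)) (jumpSwaps-1+m m)
  σ′[2+m] : phi f′ (2 + m) ≡ m
  σ′[2+m] = trans (σ′-new (2 + m) (m<1+k+m 1 m)) (jumpSwaps-2+m m)
  σ′[3+m] : phi f′ (3 + m) ≡ 1 + m
  σ′[3+m] = trans (σ′-new (3 + m) (m<1+k+m 2 m)) (jumpSwaps-3+m m)
  new≥m : ∀ x → m < x → x ≤ 3 + m → m ≤ phi f′ x
  new≥m x m<x x≤3+m with between-three m<x x≤3+m
  ... | inj₁ refl        = ≤-trans (m≤n+m m 2) (≤-reflexive (sym σ′[1+m]))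
  ... | inj₂ (inj₁ refl) = ≤-reflexive (sym σ′[2+m])
  ... | inj₂ (inj₂ refl) = ≤-trans (m≤n+m m 1) (≤-reflexive (sym σ′[3+m]))
  noNewTriple : ∀ a b c → m < a → a < b → b < c → c ≤ 3 + m →
    ¬ (phi f′ c < phi f′ a × phi f′ a < phi f′ b)
  noNewTriple a b c m<a a<b b<c c≤3+m (_ , σ′a<σ′b) =
    <⇒≱ (subst₂ _<_ (trans (cong (phi f′) a≡1+m) σ′[1+m])
                    (trans (cong (phi f′) b≡2+m) σ′[2+m]) σ′a<σ′b)
        (m≤n+m m 2)
    where
    a≡1+m : a ≡ 1 + m
    a≡1+m = ≤-antisym (≤-pred (≤-pred (≤-trans (≤-trans (s≤s a<b) b<c) c≤3+m))) m<a
    b≡2+m : b ≡ 2 + m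
    b≡2+m = ≤-antisym (≤-pred (≤-trans b<c c≤3+m)) (≤-trans (s≤s m<a) a<b)

X⇒Nondec231 : ∀ {n f} → X n f → Nondec231 n f
X⇒Nondec231 X1                    = Nondec231-∷ʳ-suc-length [] Nondec231-[]
X⇒Nondec231 X2a                   = Nondec231-∷ʳ-length (1 ∷ []) ≤-refl (X⇒Nondec231 X1)
X⇒Nondec231 X2b                   = Nondec231-∷ʳ-suc-length (1 ∷ []) (X⇒Nondec231 X1)
X⇒Nondec231 (stepA {f = f} 2≤m x) = Nondec231-∷ʳ-length f (<⇒≤ 2≤m) (X⇒Nondec231 x)
X⇒Nondec231 (stepB {f = f} _ x)   = Nondec231-∷ʳ-suc-length f (X⇒Nondec231 x)
X⇒Nondec231 (jump {m} {f} 1≤m x)  =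
  subst (λ n → Nondec231 n (f ++ m ∷ m ∷ suc m ∷ [])) (+-comm 3 m)
    (Nondec231-++-jump f 1≤m (X⇒Nondec231 x))

proposition5p6 : ∀ (n : ℕ) → 1 ≤ n → (f : List ℕ) → X n f →
    NondecSubexceedant n f × InSnNondec231 n (phi f)
proposition5p6 n _ f x with X⇒Nondec231 x
... | nondec , avoids = nondec , (f , nondec , λ _ _ _ → refl) , avoids
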